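{- Let $evs\in\mathit{nsl}$ and suppose $\mathit{Crypt}\ (\mathit{pubK}\ B)\ \langle\mathit{Nonce}\ NA,\mathit{Agent}\ A\rangle\in\mathit{parts}(\mathit{spies}\ evs)$, $\mathit{Crypt}\ (\mathit{pubK}\ B')\ \langle\mathit{Nonce}\ NA,\mathit{Agent}\ A'\rangle\in\mathit{parts}(\mathit{spies}\ evs)$ and $\mathit{Nonce}\ NA\notin\mathit{analz}(\mathit{spies}\ evs)$. Then $A=A'$ and $B=B'$.
   Context: Messages: free datatype msg ::= Number nat | Nonce nat | Agent agent | Key key | Hash msg | ⟨msg,msg⟩ | Crypt key msg; ⟨X,Y,Z⟩ abbreviates ⟨X,⟨Y,Z⟩⟩. Each agent $A$ has a public key $\mathit{pubK}\ A$ and private key $\mathit{priK}\ A$, inverse to each other under $\mathit{invKey}$. $\mathit{parts}\ H$ closes $H$ under pair components and encryption bodies; $\mathit{analz}\ H$ closes $H$ under pair components and decryption of $\mathit{Crypt}\ K\ X$ when $\mathit{Key}(\mathit{invKey}\ K)$ is already in it; $\mathit{synth}\ H$ closes $H$ under adding agent names, numbers, hashing, pairing and encryption with keys $\mathit{Key}\ K\in H$. Events are $\mathit{Says}\ A\ B\ X$; $\mathit{set}\ evs$ is the set of events of trace $evs$; $\mathit{spies}\ evs$ is the spy's knowledge: its initial knowledge (all public keys, private keys of compromised agents) plus every message sent in $evs$; $\mathit{used}\ evs$ is the parts of all messages sent (and of initial knowledge). $\mathit{nsl}$ is the least set of traces with: $[]\in\mathit{nsl}$; (Fake) $evs\in\mathit{nsl}$,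 $X\in\mathit{synth}(\mathit{analz}(\mathit{spies}\ evs))\Rightarrow \mathit{Says}\ \mathit{Spy}\ B\ X\#evs\in\mathit{nsl}$; (NS1) $evs\in\mathit{nsl}$, $\mathit{Nonce}\ NA\notin\mathit{used}\ evs\Rightarrow \mathit{Says}\ A\ B\ (\mathit{Crypt}(\mathit{pubK}\ B)\langle\mathit{Nonce}\ NA,\mathit{Agent}\ A\rangle)\#evs\in\mathit{nsl}$; (NS2) $evs\in\mathit{nsl}$, $\mathit{Nonce}\ NB\notin\mathit{used}\ evs$, $\mathit{Says}\ A'\ B\ (\mathit{Crypt}(\mathit{pubK}\ B)\langle\mathit{Nonce}\ NA,\mathit{Agent}\ A\rangle)\in\mathit{set}\ evs\Rightarrow \mathit{Says}\ B\ A\ (\mathit{Crypt}(\mathit{pubK}\ A)\langle\mathit{Nonce}\ NA,\mathit{Nonce}\ NB,\mathit{Agent}\ B\rangle)\#evs\in\mathit{nsl}$; (NS3) $evs\in\mathit{nsl}$, $\mathit{Says}\ A\ B\ (\mathit{Crypt}(\mathit{pubK}\ B)\langle\mathit{Nonce}\ NA,\mathit{Agent}\ A\rangle)\in\mathit{set}\ evs$, $\mathit{Says}\ B'\ A\ (\mathit{Crypt}(\mathit{pubK}\ A)\langle\mathit{Nonce}\ NA,\mathit{Nonce}\ NB,\mathit{Agent}\ B\rangle)\in\mathit{set}\ evs\Rightarrow\mathit{Says}\ A\ B\ (\mathit{Crypt}(\mathit{pubK}\ B)(\mathit{Nonce}\ NB))\#evs\in\mathit{nsl}$. -}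

module Defs where

open import Data.Nat using (ℕ)
open import Data.List using (List; []; _∷_)
open import Data.List.Membership.Propositional using (_∈_)
open import Data.Sum using (_⊎_)
open import Relation.Nullary using (¬_)

data Agent : Set where
  Server : Agent
  Friend : ℕ → Agent
  Spy    : Agent

data Key : Set where
  pubK : Agent → Key
  priK : Agent → Key

invKey : Key → Key
invKey (pubK a) = priK a
invKey (priK a) = pubK a

data Msg : Set where
  Number : ℕ → Msg
  Nonce  : ℕ → Msg
  Agnt   : Agent → Msg
  Ky     : Key → Msg
  Hash   : Msg → Msg
  ⟨_,_⟩  : Msg → Msg → Msg
  Crypt  : Key → Msg → Msg

MsgSet : Set₁
MsgSet = Msg → Set

data parts (H : MsgSet) : MsgSet where
  inj   : ∀ {X} → H X → parts H X
  fst   : ∀ {X Y} → parts H ⟨ X , Y ⟩ → parts H X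
  snd   : ∀ {X Y} → parts H ⟨ X , Y ⟩ → parts H Y
  body  : ∀ {K X} → parts H (Crypt K X) → parts H X

data analz (H : MsgSet) : MsgSet where
  inj     : ∀ {X} → H X → analz H X
  fst     : ∀ {X Y} → analz H ⟨ X , Y ⟩ → analz H X
  snd     : ∀ {X Y} → analz H ⟨ X , Y ⟩ → analz H Y
  decrypt : ∀ {K X} → analz H (Crypt K X) → analz H (Ky (invKey K)) → analz H X

data synth (H : MsgSet) : MsgSet where
  inj    : ∀ {X} → H X → synth H X
  agent  : ∀ a → synth H (Agnt a)
  number : ∀ n → synth H (Number n)
  hash   : ∀ {X} → synth H X → synth H (Hash X)
  pair   : ∀ {X Y} → synth H X → synth H Y → synth H ⟨ X , Y ⟩
  crypt  : ∀ {K X} → synth H (Ky K) → synth H X → synth H (Crypt K X)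

data Event : Set where
  Says : Agent → Agent → Msg → Event

Trace : Set
Trace = List Event

data initSpy (bad : Agent → Set) : MsgSet where
  pub  : ∀ a → initSpy bad (Ky (pubK a))
  priv : ∀ {a} → bad a → initSpy bad (Ky (priK a))

data sent : Trace → MsgSet where
  here  : ∀ {A B X evs} → sent (Says A B X ∷ evs) X
  there : ∀ {e evs X} → sent evs X → sent (e ∷ evs) X

spies : (bad : Agent → Set) → Trace → MsgSet
spies bad evs X = initSpy bad X ⊎ sent evs X

used : (bad : Agent → Set) → Trace → MsgSet
used bad evs = parts (spies bad evs)

data nsl (bad : Agent → Set) : Trace → Set where
  Nil  : nsl bad []
  Fake : ∀ {evs B X} → nsl bad evs →
         synth (analz (spies bad evs)) X →
         nsl bad (Says Spy B X ∷ evs)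
  NS1  : ∀ {evs A B NA} → nsl bad evs →
         ¬ used bad evs (Nonce NA) →
         nsl bad (Says A B (Crypt (pubK B) ⟨ Nonce NA , Agnt A ⟩) ∷ evs)
  NS2  : ∀ {evs A A' B NA NB} → nsl bad evs →
         ¬ used bad evs (Nonce NB) →
         Says A' B (Crypt (pubK B) ⟨ Nonce NA , Agnt A ⟩) ∈ evs →
         nsl bad (Says B A (Crypt (pubK A) ⟨ Nonce NA , ⟨ Nonce NB , Agnt B ⟩ ⟩) ∷ evs)
  NS3  : ∀ {evs A B B' NA NB} → nsl bad evs →
         Says A B (Crypt (pubK B) ⟨ Nonce NA , Agnt A ⟩) ∈ evs →
         Says B' A (Crypt (pubK A) ⟨ Nonce NA , ⟨ Nonce NB , Agnt B ⟩ ⟩) ∈ evs →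
         nsl bad (Says A B (Crypt (pubK B) (Nonce NB)) ∷ evs)

{-# OPTIONS --safe #-}
-- A ciphertext Crypt K ⟨ Nonce NA , Agnt A ⟩ can enter the
-- spy's view in only two ways: by an NS1 step, whose nonce is fresh, so that the new
-- ciphertext is the first one to contain NA; or by a Fake step, where the spy cannot
-- build it himself without analysing NA and therefore merely replays a ciphertext he
-- has already seen.  Hence all such ciphertexts with the same secret NA coincide.
module Submission where

open import Defs
open import Data.Nat using (ℕ)
open import Data.List using ([]; _∷_)
open import Data.Product using (_×_; _,_; ∃)
open import Data.Sum using (_⊎_; inj₁; inj₂)
import Data.Sum as Sum
open import Data.Empty using (⊥-elim)
open import Function using (_∘_)
open import Relation.Binary.PropositionalEquality using (_≡_; refl; sym; trans)
open import Relation.Nullary using (¬_)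

infix 4 _⊑_

data _⊑_ : Msg → Msg → Set where
  here : ∀ {X} → X ⊑ X
  inl  : ∀ {X Y Z} → X ⊑ Y → X ⊑ ⟨ Y , Z ⟩
  inr  : ∀ {X Y Z} → X ⊑ Z → X ⊑ ⟨ Y , Z ⟩
  inb  : ∀ {X K Y} → X ⊑ Y → X ⊑ Crypt K Y

⊑-trans : ∀ {X Y Z} → X ⊑ Y → Y ⊑ Z → X ⊑ Z
⊑-trans s here    = s
⊑-trans s (inl t) = inl (⊑-trans s t)
⊑-trans s (inr t) = inr (⊑-trans s t)
⊑-trans s (inb t) = inb (⊑-trans s t)

parts-⊑ : ∀ {H X Y} → parts H X → Y ⊑ X → parts H Y
parts-⊑ p here    = p
parts-⊑ p (inl s) = parts-⊑ (fst p) s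
parts-⊑ p (inr s) = parts-⊑ (snd p) s
parts-⊑ p (inb s) = parts-⊑ (body p) s

analz⊆parts : ∀ {H X} → analz H X → parts H X
analz⊆parts (inj h)       = inj h
analz⊆parts (fst a)       = fst (analz⊆parts a)
analz⊆parts (snd a)       = snd (analz⊆parts a)
analz⊆parts (decrypt a _) = body (analz⊆parts a)

parts-analz : ∀ {H X} → parts (analz H) X → parts H X
parts-analz (inj a)  = analz⊆parts a
parts-analz (fst p)  = fst (parts-analz p)
parts-analz (snd p)  = snd (parts-analz p)
parts-analz (body p) = body (parts-analz p)

analz-mono : ∀ {H H' : MsgSet} → (∀ {X} → H X → H' X) → ∀ {X} → analz H X → analz H' X
analz-mono f (inj h)       = inj (f h)
analz-mono f (fst a)       = fst (analz-mono f a)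
analz-mono f (snd a)       = snd (analz-mono f a)
analz-mono f (decrypt a k) = decrypt (analz-mono f a) (analz-mono f k)

⊑-synth : ∀ {G X Y} → synth G X → Y ⊑ X → synth G Y ⊎ parts G Y
⊑-synth (inj g)     s       = inj₂ (parts-⊑ (inj g) s)
⊑-synth x           here    = inj₁ x
⊑-synth (pair x _)  (inl s) = ⊑-synth x s
⊑-synth (pair _ y)  (inr s) = ⊑-synth y s
⊑-synth (crypt _ x) (inb s) = ⊑-synth x s

Crypt-synth-analz : ∀ {H K n Y} → synth (analz H) (Crypt K ⟨ Nonce n , Y ⟩) →
                    ¬ analz H (Nonce n) → analz H (Crypt K ⟨ Nonce n , Y ⟩)
Crypt-synth-analz (inj a)                    _      = a
Crypt-synth-analz (crypt _ (inj a))          secret = ⊥-elim (secret (fst a))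
Crypt-synth-analz (crypt _ (pair (inj a) _)) secret = ⊥-elim (secret a)

spies-mono : ∀ {bad e evs X} → spies bad evs X → spies bad (e ∷ evs) X
spies-mono (inj₁ i) = inj₁ i
spies-mono (inj₂ s) = inj₂ (there s)

parts-spies-[] : ∀ {bad X} → parts (spies bad []) X → ∃ λ K → X ≡ Ky K
parts-spies-[] (inj (inj₁ (pub a)))  = pubK a , refl
parts-spies-[] (inj (inj₁ (priv _))) = priK _ , refl
parts-spies-[] (fst p) with parts-spies-[] p
... | _ , ()
parts-spies-[] (snd p) with parts-spies-[] p
... | _ , ()
parts-spies-[] (body p) with parts-spies-[] p
... | _ , ()

parts-spies-Says : ∀ {bad A B M evs X} → parts (spies bad (Says A B M ∷ evs)) X →
                   X ⊑ M ⊎ parts (spies bad evs) X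
parts-spies-Says (inj (inj₁ i))         = inj₂ (inj (inj₁ i))
parts-spies-Says (inj (inj₂ here))      = inj₁ here
parts-spies-Says (inj (inj₂ (there s))) = inj₂ (inj (inj₂ s))
parts-spies-Says (fst p)  = Sum.map (⊑-trans (inl here)) fst  (parts-spies-Says p)
parts-spies-Says (snd p)  = Sum.map (⊑-trans (inr here)) snd  (parts-spies-Says p)
parts-spies-Says (body p) = Sum.map (⊑-trans (inb here)) body (parts-spies-Says p)

nsl-tail : ∀ {bad e evs} → nsl bad (e ∷ evs) → nsl bad evs
nsl-tail (Fake ev _)  = ev
nsl-tail (NS1 ev _)   = ev
nsl-tail (NS2 ev _ _) = ev
nsl-tail (NS3 ev _ _) = ev

msg₁ : Key → ℕ → Agent → Msg
msg₁ K n A = Crypt K ⟨ Nonce n , Agnt A ⟩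

⊑-msg₁ : ∀ {K n A K' n' A'} → msg₁ K n A ⊑ msg₁ K' n' A' → msg₁ K n A ≡ msg₁ K' n' A'
⊑-msg₁ here = refl
⊑-msg₁ (inb (inl ()))
⊑-msg₁ (inb (inr ()))

msg₁⋢msg₂ : ∀ {K n A K' n' m B} → ¬ msg₁ K n A ⊑ Crypt K' ⟨ Nonce n' , ⟨ Nonce m , Agnt B ⟩ ⟩
msg₁⋢msg₂ (inb (inl ()))
msg₁⋢msg₂ (inb (inr (inl ())))
msg₁⋢msg₂ (inb (inr (inr ())))

msg₁⋢msg₃ : ∀ {K n A K' m} → ¬ msg₁ K n A ⊑ Crypt K' (Nonce m)
msg₁⋢msg₃ (inb ())

message : Event → Msg
message (Says _ _ X) = X

msg₁-origin : ∀ {bad e evs K n A} → nsl bad (e ∷ evs) →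
              parts (spies bad (e ∷ evs)) (msg₁ K n A) → ¬ analz (spies bad (e ∷ evs)) (Nonce n) →
              parts (spies bad evs) (msg₁ K n A) ⊎ (msg₁ K n A ≡ message e × ¬ used bad evs (Nonce n))
msg₁-origin {e = Says _ _ _} ev p secret with parts-spies-Says p
msg₁-origin _ _ _ | inj₂ old = inj₁ old
msg₁-origin (Fake _ X) _ secret | inj₁ s with ⊑-synth X s
... | inj₁ x   = inj₁ (analz⊆parts (Crypt-synth-analz x (secret ∘ analz-mono spies-mono)))
... | inj₂ old = inj₁ (parts-analz old)
msg₁-origin (NS1 _ fresh) _ _ | inj₁ s with ⊑-msg₁ s
... | refl = inj₂ (refl , fresh)
msg₁-origin (NS2 _ _ _) _ _ | inj₁ s = ⊥-elim (msg₁⋢msg₂ s)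
msg₁-origin (NS3 _ _ _) _ _ | inj₁ s = ⊥-elim (msg₁⋢msg₃ s)

msg₁-unique : ∀ {bad evs K K' n A A'} → nsl bad evs →
              parts (spies bad evs) (msg₁ K n A) → parts (spies bad evs) (msg₁ K' n A') →
              ¬ analz (spies bad evs) (Nonce n) → msg₁ K n A ≡ msg₁ K' n A'
msg₁-unique Nil p _ _ with parts-spies-[] p
... | _ , ()
msg₁-unique {evs = _ ∷ _} ev p q secret
  with msg₁-origin ev p secret | msg₁-origin ev q secret
... | inj₁ p′          | inj₁ q′          = msg₁-unique (nsl-tail ev) p′ q′ (secret ∘ analz-mono spies-mono)
... | inj₂ (p≡e , _)   | inj₂ (q≡e , _)   = trans p≡e (sym q≡e)
... | inj₂ (_ , fresh) | inj₁ q′          = ⊥-elim (fresh (fst (body q′)))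
... | inj₁ p′          | inj₂ (_ , fresh) = ⊥-elim (fresh (fst (body p′)))

-- The secrecy of NA is assumed outright, so whether the spy is compromised is irrelevant.
mainTheorem6 : (bad : Agent → Set) → bad Spy →
    ∀ {evs : Trace} {A A' B B' : Agent} {NA : ℕ} →
    nsl bad evs →
    parts (spies bad evs) (Crypt (pubK B) ⟨ Nonce NA , Agnt A ⟩) →
    parts (spies bad evs) (Crypt (pubK B') ⟨ Nonce NA , Agnt A' ⟩) →
    ¬ analz (spies bad evs) (Nonce NA) →
    (A ≡ A') × (B ≡ B')
mainTheorem6 _ _ ev p q secret with msg₁-unique ev p q secret
... | refl = refl , refl
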